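{- Let $T$ be a set of rooted binary phylogenetic trees on the same leaf set $X$, let $C$ be a constraint set on $T$, and let $s$ be a cherry picking sequence for $T$ satisfying $C$. Let $x$ be a leaf with $x\notin\pi_1(C)$ and $x\notin\pi_2(C)$. If $x\in H(T)$ and $w_T(x)=0$, then there is a cherry picking sequence $s'$ for $T$ with $s'_1=x$ and $w_T(s')=w_T(s)$ that satisfies $C$.
   Context: A tree is a rooted binary phylogenetic $X$-tree. $\mathcal{T}\setminus A$ is obtained by deleting the leaves in $A$ and repeatedly suppressing vertices with in- and out-degree one; $T\setminus A=\{\mathcal{T}\setminus A:\mathcal{T}\in T\}$. A cherry is a pair of leaves with a common parent; $(a,b)\in\mathcal{T}$ (symmetric) means $\{a,b\}$ is a cherry of $\mathcal{T}$; $(a,b)\in T$ means it is a cherry of some tree in $T$. $H(T)$ is the set of leaves in a cherry in every tree of $T$. $N_T(x)=\{y:(y,x)\in\mathcal{T}\text{ for some }\mathcal{T}\in T\}$, $w_T(x)=|N_T(x)|-1$. A cherry picking sequence for $T$ is a sequence $s=(s_1,\dots,s_n)$ containing each leaf exactly once with $s_i\in H(T\setminus\{s_1,\dots,s_{i-1}\})$ for $i\le n-1$; its weight is $w_T(s)=\sum_{i=1}^{n-1}w_{T\setminus\{s_1,\dots,s_{i-1}\}}(s_i)$. A constraint set on $T$ is $C\subseteq X\times X$ with every pair a cherry in $T$; $s$ satisfies $C$ if for every $(a,b)\in C$ there is $i$ with $s_i=a$, $(a,b)\in T'$ and $w_{T'}(a)>0$, where $T'=T\setminus\{s_1,\dots,s_{i-1}\}$.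 $\pi_1(C)=\{a:(a,b)\in C\}$, $\pi_2(C)=\{b:(a,b)\in C\}$. -}

module Defs where

open import Data.Nat using (ℕ; zero; suc)
open import Data.Fin using (Fin)
open import Data.Fin.Properties using (_≟_)
open import Data.Fin.Subset using (Subset; ∣_∣)
open import Data.Bool using (Bool; true; false; _∧_; _∨_; if_then_else_; T)
open import Data.Maybe using (Maybe; just; nothing)
open import Data.List using (List; []; _∷_; _++_; [_]; map; mapMaybe; allFin)
open import Data.Bool.ListAction using (any)
open import Data.List.Relation.Unary.All using (All)
open import Data.List.Relation.Unary.Any using (Any)
open import Data.List.Relation.Binary.Permutation.Propositional using (_↭_)
open import Data.List.Membership.Propositional using (_∈_; _∉_)
import Data.List.Membership.DecPropositional as DecMem
open import Data.Vec using (tabulate)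
open import Data.Integer using (ℤ; +_; _-_; _+_; _>_; 0ℤ; 1ℤ)
open import Data.Product using (Σ; ∃; ∃-syntax; _×_; _,_; proj₁; proj₂)
open import Data.Unit using (⊤)
open import Relation.Nullary using (¬_; does)
open import Relation.Nullary.Decidable using (⌊_⌋)
open import Relation.Binary.PropositionalEquality using (_≡_; _≢_)

-- Rooted binary trees with leaves labelled by A (children unordered for all
-- purposes below: only cherries and leaf deletion are used).
data BTree (A : Set) : Set where
  leaf : A → BTree A
  node : BTree A → BTree A → BTree A

leaves : {A : Set} → BTree A → List A
leaves (leaf a)   = a ∷ []
leaves (node l r) = leaves l ++ leaves r

-- Leaf set X = Fin n.  A rooted binary phylogenetic X-tree: every element of X
-- labels exactly one leaf.
Tree : ℕ → Set
Tree n = BTree (Fin n)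

IsPhyloTree : (n : ℕ) → Tree n → Set
IsPhyloTree n t = leaves t ↭ allFin n

-- A finite set of trees, represented as a list.
Forest : ℕ → Set
Forest n = List (Tree n)

module _ {n : ℕ} where

  open DecMem (_≟_ {n}) using (_∈?_)

  siblingCherry : Tree n → Tree n → Fin n → Fin n → Bool
  siblingCherry (leaf u) (leaf v) a b =
    (⌊ u ≟ a ⌋ ∧ ⌊ v ≟ b ⌋) ∨ (⌊ u ≟ b ⌋ ∧ ⌊ v ≟ a ⌋)
  siblingCherry _ _ a b = false

  isCherry : Tree n → Fin n → Fin n → Bool
  isCherry (leaf _)   a b = false
  isCherry (node l r) a b = siblingCherry l r a b ∨ (isCherry l a b ∨ isCherry r a b)

  CherryOf : Tree n → Fin n → Fin n → Set
  CherryOf t a b = T (isCherry t a b)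

  CherryIn : Forest n → Fin n → Fin n → Set
  CherryIn Ts a b = Any (λ t → CherryOf t a b) Ts

  -- Deleting the leaves in A and suppressing degree-two vertices
  -- (nothing = the empty tree, when all leaves are deleted).
  join : Maybe (Tree n) → Maybe (Tree n) → Maybe (Tree n)
  join nothing  m        = m
  join (just l) nothing  = just l
  join (just l) (just r) = just (node l r)

  deleteT : List (Fin n) → Tree n → Maybe (Tree n)
  deleteT A (leaf a)   = if does (a ∈? A) then nothing else just (leaf a)
  deleteT A (node l r) = join (deleteT A l) (deleteT A r)

  _∖_ : Forest n → List (Fin n) → Forest n
  Ts ∖ A = mapMaybe (deleteT A) Ts

  InH : Forest n → Fin n → Set
  InH Ts x = All (λ t → ∃[ y ] CherryOf t x y) Ts

  N : Forest n → Fin n → Subset n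
  N Ts x = tabulate (λ y → any (λ t → isCherry t y x) Ts)

  w : Forest n → Fin n → ℤ
  w Ts x = (+ ∣ N Ts x ∣) - 1ℤ

  -- Cherry picking conditions: s_i ∈ H(T \ {s_1..s_{i-1}}) for all i ≤ n-1.
  -- `del` is the prefix {s_1,...,s_{i-1}} already picked.
  CPSteps : Forest n → List (Fin n) → List (Fin n) → Set
  CPSteps Ts del []            = ⊤
  CPSteps Ts del (x ∷ [])      = ⊤
  CPSteps Ts del (x ∷ y ∷ rest) = InH (Ts ∖ del) x × CPSteps Ts (del ++ [ x ]) (y ∷ rest)

  IsCPS : Forest n → List (Fin n) → Set
  IsCPS Ts s = (s ↭ allFin n) × CPSteps Ts [] s

  weightFrom : Forest n → List (Fin n) → List (Fin n) → ℤ
  weightFrom Ts del []             = 0ℤ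
  weightFrom Ts del (x ∷ [])       = 0ℤ
  weightFrom Ts del (x ∷ y ∷ rest) = w (Ts ∖ del) x + weightFrom Ts (del ++ [ x ]) (y ∷ rest)

  weight : Forest n → List (Fin n) → ℤ
  weight Ts s = weightFrom Ts [] s

  IsConstraintSet : Forest n → List (Fin n × Fin n) → Set
  IsConstraintSet Ts C = All (λ p → CherryIn Ts (proj₁ p) (proj₂ p)) C

  Satisfies : Forest n → List (Fin n × Fin n) → List (Fin n) → Set
  Satisfies Ts C s = All (λ p →
      ∃[ pre ] ∃[ post ] (s ≡ pre ++ (proj₁ p ∷ post))
        × CherryIn (Ts ∖ pre) (proj₁ p) (proj₂ p)
        × (w (Ts ∖ pre) (proj₁ p) > 0ℤ)) C

  π₁ : List (Fin n × Fin n) → List (Fin n)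
  π₁ C = map proj₁ C

  π₂ : List (Fin n × Fin n) → List (Fin n)
  π₂ C = map proj₂ C

module Submission where

-- Since w_T(x) = 0, all cherries containing x share one partner y (common-partner),
-- so {x,y} is a cherry of every tree.  While neither x nor y is picked this persists,
-- x and y both have weight 0, and
--   * deleting x only contracts the cherry {x,y} into the leaf y, which leaves the
--     cherries, H-membership and weight of every other leaf of H unchanged
--     (delete-x-keeps), while
--   * deleting x gives the forest obtained by deleting y, with the labels x and y
--     swapped (delete-x≡rename-delete-y); relabelling preserves weights (transpose-w).
-- So if y is picked after x, x is moved to the front (move-x-front); otherwise x and
-- y are first exchanged (swap-x-y).

open import Defs
open import Data.Bool using (Bool; true; false; T; _∧_; _∨_; if_then_else_)
open import Data.Bool.ListAction using (any)
open import Data.Bool.Properties using (T-∨; T-∧; T-≡)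
open import Data.Empty using (⊥; ⊥-elim)
open import Data.Fin using (Fin; zero; suc)
open import Data.Fin.Permutation.Components using (transpose; transpose-inverse)
open import Data.Fin.Properties using (_≟_)
open import Data.Fin.Subset using (∣_∣)
open import Data.Integer as ℤ using (+_; _-_; 0ℤ; 1ℤ; _>_; +<+)
open import Data.Integer.Properties using (+-identityˡ)
open import Data.List using (List; []; _∷_; _++_; [_]; map; mapMaybe; catMaybes)
open import Data.List.Membership.Propositional using (_∈_; _∉_)
open import Data.List.Membership.Propositional.Properties using (∈-++⁺ˡ; ∈-++⁺ʳ; ∈-++⁻; ∈-∃++; ∈-allFin)
import Data.List.Membership.DecPropositional as DecMembership
open import Data.List.Properties using (map-cong-local; map-mapMaybe; mapMaybe-cong; ++-assoc; ++-identityʳ; ∷-injective)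
open import Data.List.Relation.Binary.Permutation.Propositional using (_↭_; ↭-sym; ↭-trans; ↭-reflexive; ↭⇒↭ₛ; prep; swap; refl)
open import Data.List.Relation.Binary.Permutation.Propositional.Properties using (∈-resp-↭; ++⁺ʳ; ++⁺ˡ; ++-comm; shift)
open import Data.List.Relation.Binary.Permutation.Setoid.Properties using (Unique-resp-↭)
open import Data.List.Relation.Binary.Pointwise using (Pointwise; []; _∷_)
open import Data.List.Relation.Unary.All using (All; []; _∷_)
import Data.List.Relation.Unary.All as All
import Data.List.Relation.Unary.All.Properties as AllP
open import Data.List.Relation.Unary.AllPairs using ([]; _∷_)
open import Data.List.Relation.Unary.Any using (Any; here; there)
import Data.List.Relation.Unary.Any as Any
open import Data.List.Relation.Unary.Any.Properties using (any⁺; any⁻)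
open import Data.List.Relation.Unary.Unique.Propositional using (Unique)
open import Data.List.Relation.Unary.Unique.Propositional.Properties using (allFin⁺)
open import Data.Maybe using (Maybe; just; nothing; _>>=_)
import Data.Maybe as Maybe
import Data.Maybe.Relation.Unary.All as MaybeAll
open import Data.Nat using (ℕ; zero; suc; _+_)
open import Data.Nat.Properties using (+-commutativeSemigroup)
open import Algebra.Properties.CommutativeSemigroup +-commutativeSemigroup using (x∙yz≈y∙xz)
open import Data.Product using (∃-syntax; _×_; _,_; proj₁; proj₂)
open import Data.Sum using (inj₁; inj₂; [_,_]′)
open import Data.Unit using (⊤; tt)
open import Data.Vec using (tabulate)
open import Function using (_∘_; _⇔_; mk⇔; Equivalence; Injective)
open import Relation.Binary.PropositionalEquality using (_≡_; _≢_; refl; sym; trans; cong; cong₂; subst; subst₂; setoid; module ≡-Reasoning)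
open import Relation.Nullary using (¬_; yes; no)
open import Relation.Nullary.Decidable using (⌊_⌋; toWitness; fromWitness)

open Equivalence using (to; from)

T-injective : ∀ {p q} → (T p → T q) → (T q → T p) → p ≡ q
T-injective {true}  {true}  _ _ = refl
T-injective {true}  {false} f _ = ⊥-elim (f _)
T-injective {false} {true}  _ g = ⊥-elim (g _)
T-injective {false} {false} _ _ = refl

module _ {A B : Set} where

  mapMaybe-pointwise : ∀ {f : A → Maybe B} {R : A → B → Set} {xs} →
    All (λ a → ∃[ b ] f a ≡ just b × R a b) xs → Pointwise R xs (mapMaybe f xs)
  mapMaybe-pointwise [] = []
  mapMaybe-pointwise {f} {xs = a ∷ _} ((b , _ , r) ∷ rest) with f a
  mapMaybe-pointwise ((b , refl , r) ∷ rest) | just .b = r ∷ mapMaybe-pointwise rest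

  mapMaybe-cong-All : ∀ {f g : A → Maybe B} {xs} → All (λ a → f a ≡ g a) xs → mapMaybe f xs ≡ mapMaybe g xs
  mapMaybe-cong-All f≡g = cong catMaybes (map-cong-local f≡g)

  pointwise-≢[] : ∀ {R : A → B → Set} {xs ys} → Pointwise R xs ys → xs ≢ [] → ys ≢ []
  pointwise-≢[] []      xs≢[] = ⊥-elim (xs≢[] refl)
  pointwise-≢[] (_ ∷ _) _     = λ ()

  pointwise-All : ∀ {R : A → B → Set} {P : B → Set} → (∀ {a b} → R a b → P b) →
                  ∀ {xs ys} → Pointwise R xs ys → All P ys
  pointwise-All R⇒P []       = []
  pointwise-All R⇒P (r ∷ rs) = R⇒P r ∷ pointwise-All R⇒P rs

module _ {A B C : Set} where

  mapMaybe->>= : ∀ (f : A → Maybe B) (g : B → Maybe C) xs →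
                 mapMaybe (λ a → f a >>= g) xs ≡ mapMaybe g (mapMaybe f xs)
  mapMaybe->>= f g [] = refl
  mapMaybe->>= f g (a ∷ xs) with f a
  ... | nothing = mapMaybe->>= f g xs
  ... | just b with g b
  ...   | nothing = mapMaybe->>= f g xs
  ...   | just c  = cong (c ∷_) (mapMaybe->>= f g xs)

module _ {A : Set} where

  ∈⇒≢[] : ∀ {a : A} {xs} → a ∈ xs → xs ≢ []
  ∈⇒≢[] (here _)  ()
  ∈⇒≢[] (there _) ()

  ++-≢[] : ∀ (P : List A) {Q} → Q ≢ [] → P ++ Q ≢ []
  ++-≢[] []      Q≢[] = Q≢[]
  ++-≢[] (_ ∷ _) _    = λ ()

  unique-++ : ∀ xs {ys : List A} → Unique (xs ++ ys) → Unique xs × Unique ys × (∀ {a} → a ∈ xs → a ∈ ys → ⊥)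
  unique-++ []       u        = [] , u , λ ()
  unique-++ (x ∷ xs) (x∉ ∷ u) with unique-++ xs u
  ... | uxs , uys , disj = AllP.++⁻ˡ xs x∉ ∷ uxs , uys , λ where
    (here refl) a∈ys → All.lookup (AllP.++⁻ʳ xs x∉) a∈ys refl
    (there a∈xs) a∈ys → disj a∈xs a∈ys

  unique-middle : ∀ xs {u : A} {ys} → Unique (xs ++ u ∷ ys) → u ∉ xs × u ∉ ys
  unique-middle xs un with unique-++ xs un
  ... | _ , (u∉ys ∷ _) , disj = (λ u∈xs → disj u∈xs (here refl)) , (λ u∈ys → All.lookup u∉ys u∈ys refl)

data Split {A : Set} (P : List A) (u : A) (L pre : List A) (a : A) (post : List A) : Set where
  before : ∀ m → P ≡ pre ++ a ∷ m → post ≡ m ++ u ∷ L → Split P u L pre a post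
  at     : pre ≡ P → a ≡ u → post ≡ L → Split P u L pre a post
  after  : ∀ m → pre ≡ P ++ u ∷ m → L ≡ m ++ a ∷ post → Split P u L pre a post

split : ∀ {A : Set} (P : List A) u L pre a post → P ++ u ∷ L ≡ pre ++ a ∷ post → Split P u L pre a post
split []      u L []        a post refl = at refl refl refl
split []      u L (p ∷ pre) a post refl = after pre refl refl
split (q ∷ P) u L []        a post refl = before P refl refl
split (q ∷ P) u L (p ∷ pre) a post e with ∷-injective e
... | refl , e′ with split P u L pre a post e′
...   | before m P≡ post≡ = before m (cong (q ∷_) P≡) post≡
...   | at pre≡ a≡ post≡  = at (cong (q ∷_) pre≡) a≡ post≡
...   | after m pre≡ L≡   = after m (cong (q ∷_) pre≡) L≡

exchange-↭ : ∀ {A : Set} P (u v : A) Q R → P ++ u ∷ (Q ++ v ∷ R) ↭ P ++ v ∷ (Q ++ u ∷ R)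
exchange-↭ P u v Q R = ++⁺ˡ P (↭-trans (shift v (u ∷ Q) R) (prep v (↭-sym (shift u Q R))))

bit : Bool → ℕ
bit true  = 1
bit false = 0

count : ∀ {n} → (Fin n → Bool) → ℕ
count {zero}  f = 0
count {suc n} f = bit (f zero) + count (λ j → f (suc j))

∣tabulate∣≡count : ∀ {n} (f : Fin n → Bool) → ∣ tabulate f ∣ ≡ count f
∣tabulate∣≡count {zero}  f = refl
∣tabulate∣≡count {suc n} f with f zero
... | true  = cong suc (∣tabulate∣≡count (λ j → f (suc j)))
... | false = ∣tabulate∣≡count (λ j → f (suc j))

count-cong : ∀ {n} {f g : Fin n → Bool} → (∀ j → f j ≡ g j) → count f ≡ count g
count-cong {zero}  f≗g = refl
count-cong {suc n} f≗g = cong₂ _+_ (cong bit (f≗g zero)) (count-cong (λ j → f≗g (suc j)))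

count-false : ∀ {n} (f : Fin n → Bool) → (∀ j → f j ≡ false) → count f ≡ 0
count-false {zero}  f _  = refl
count-false {suc n} f f≗0 rewrite f≗0 zero = count-false (λ j → f (suc j)) (λ j → f≗0 (suc j))

remove : ∀ {n} → Fin n → (Fin n → Bool) → Fin n → Bool
remove i f j = if ⌊ j ≟ i ⌋ then false else f j

remove-≢ : ∀ {n} {i j : Fin n} (f : Fin n → Bool) → j ≢ i → remove i f j ≡ f j
remove-≢ {i = i} {j} f j≢i with j ≟ i
... | yes j≡i = ⊥-elim (j≢i j≡i)
... | no _    = refl

remove-suc : ∀ {n} (i : Fin n) (f : Fin (suc n) → Bool) j →
             remove i (λ k → f (suc k)) j ≡ remove (suc i) f (suc j)
remove-suc i f j with j ≟ i
... | yes _ = refl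
... | no _  = refl

remove-cong : ∀ {n} (i : Fin n) {f g : Fin n → Bool} {j} → (j ≢ i → f j ≡ g j) → remove i f j ≡ remove i g j
remove-cong i {j = j} f≡g with j ≟ i
... | yes _   = refl
... | no j≢i = f≡g j≢i

count-split : ∀ {n} (i : Fin n) (f : Fin n → Bool) → count f ≡ bit (f i) + count (remove i f)
count-split zero    f = refl
count-split (suc i) f = begin
  bit (f zero) + count (λ j → f (suc j))
    ≡⟨ cong (λ c → bit (f zero) + c) (count-split i (λ j → f (suc j))) ⟩
  bit (f zero) + (bit (f (suc i)) + count (remove i (λ j → f (suc j))))
    ≡⟨ x∙yz≈y∙xz (bit (f zero)) (bit (f (suc i))) (count (remove i (λ j → f (suc j)))) ⟩
  bit (f (suc i)) + (bit (f zero) + count (remove i (λ j → f (suc j))))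
    ≡⟨ cong (λ c → bit (f (suc i)) + c) (cong (λ c → bit (f zero) + c) (count-cong (remove-suc i f))) ⟩
  bit (f (suc i)) + count (remove (suc i) f) ∎
  where open ≡-Reasoning

count-split₂ : ∀ {n} {i j : Fin n} (f : Fin n → Bool) → i ≢ j →
               count f ≡ bit (f i) + (bit (f j) + count (remove j (remove i f)))
count-split₂ {i = i} {j} f i≢j = begin
  count f                                                ≡⟨ count-split i f ⟩
  bit (f i) + count (remove i f)                         ≡⟨ cong (λ c → bit (f i) + c) (count-split j (remove i f)) ⟩
  bit (f i) + (bit (remove i f j) + count (remove j (remove i f)))
    ≡⟨ cong (λ b → bit (f i) + (bit b + count (remove j (remove i f)))) (remove-≢ f (λ j≡i → i≢j (sym j≡i))) ⟩
  bit (f i) + (bit (f j) + count (remove j (remove i f))) ∎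
  where open ≡-Reasoning

count-single : ∀ {n} (f : Fin n → Bool) y → f y ≡ true → (∀ b → f b ≡ true → b ≡ y) → count f ≡ 1
count-single f y fy only-y = trans (count-split y f) (cong₂ _+_ (cong bit fy) (count-false (remove y f) off))
  where
  off : ∀ j → remove y f j ≡ false
  off j with j ≟ y
  ... | yes _  = refl
  ... | no j≢y with f j in fj
  ...   | true  = ⊥-elim (j≢y (only-y j fj))
  ...   | false = refl

count≡1-unique : ∀ {n} (f : Fin n → Bool) {i j} → count f ≡ 1 → f i ≡ true → f j ≡ true → i ≡ j
count≡1-unique f {i} {j} c fi fj with i ≟ j
... | yes i≡j = i≡j
... | no i≢j with trans (sym c) (count-split₂ f i≢j)
...   | 1≡count rewrite fi | fj with 1≡count
...     | ()

module _ {n : ℕ} (x y : Fin n) where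

  transpose-x : transpose x y x ≡ y
  transpose-x with x ≟ x
  ... | yes _   = refl
  ... | no x≢x = ⊥-elim (x≢x refl)

  transpose-y : transpose x y y ≡ x
  transpose-y with y ≟ x
  ... | yes y≡x = y≡x
  ... | no _ with y ≟ y
  ...   | yes _   = refl
  ...   | no y≢y = ⊥-elim (y≢y refl)

  transpose-other : ∀ {k} → k ≢ x → k ≢ y → transpose x y k ≡ k
  transpose-other {k} k≢x k≢y with k ≟ x
  ... | yes k≡x = ⊥-elim (k≢x k≡x)
  ... | no _ with k ≟ y
  ...   | yes k≡y = ⊥-elim (k≢y k≡y)
  ...   | no _    = refl

  transpose-injective : ∀ {j k} → transpose x y j ≡ transpose x y k → j ≡ k
  transpose-injective {j} {k} e = begin
    j                                    ≡⟨ sym (transpose-inverse y x) ⟩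
    transpose y x (transpose x y j)      ≡⟨ cong (transpose y x) e ⟩
    transpose y x (transpose x y k)      ≡⟨ transpose-inverse y x ⟩
    k                                    ∎
    where open ≡-Reasoning

  count-transpose : (f : Fin n → Bool) → x ≢ y → count (λ j → f (transpose x y j)) ≡ count f
  count-transpose f x≢y = begin
    count f∘σ
      ≡⟨ count-split₂ f∘σ x≢y ⟩
    bit (f∘σ x) + (bit (f∘σ y) + count (remove y (remove x f∘σ)))
      ≡⟨ cong₂ (λ a b → bit a + (bit b + count (remove y (remove x f∘σ)))) (cong f (transpose-x)) (cong f (transpose-y)) ⟩
    bit (f y) + (bit (f x) + count (remove y (remove x f∘σ)))
      ≡⟨ cong (λ c → bit (f y) + (bit (f x) + c)) (count-cong rest) ⟩
    bit (f y) + (bit (f x) + count (remove y (remove x f)))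
      ≡⟨ x∙yz≈y∙xz (bit (f y)) (bit (f x)) _ ⟩
    bit (f x) + (bit (f y) + count (remove y (remove x f)))
      ≡⟨ sym (count-split₂ f x≢y) ⟩
    count f ∎
    where
    open ≡-Reasoning
    f∘σ : Fin n → Bool
    f∘σ j = f (transpose x y j)
    rest : ∀ j → remove y (remove x f∘σ) j ≡ remove y (remove x f) j
    rest j with j ≟ y
    ... | yes _ = refl
    ... | no j≢y = remove-cong x {f∘σ} {f} (λ j≢x → cong f (transpose-other j≢x j≢y))

module _ {n : ℕ} where
  open DecMembership (_≟_ {n}) using (_∈?_)

  data Cherry : Tree n → Fin n → Fin n → Set where
    siblings  : ∀ {a b} → Cherry (node (leaf a) (leaf b)) a b
    siblings′ : ∀ {a b} → Cherry (node (leaf a) (leaf b)) b a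
    left      : ∀ {l r a b} → Cherry l a b → Cherry (node l r) a b
    right     : ∀ {l r a b} → Cherry r a b → Cherry (node l r) a b

  cherry⇔ : ∀ t a b → T (isCherry t a b) ⇔ Cherry t a b
  cherry⇔ t a b = mk⇔ (sound t) (complete t)
    where
    siblingsSound : ∀ l r → T (siblingCherry l r a b) → Cherry (node l r) a b
    siblingsSound (leaf u) (leaf v) p with to T-∨ p
    ... | inj₁ q with to (T-∧ {⌊ u ≟ a ⌋}) q
    ...   | ua , vb with toWitness ua | toWitness vb
    ...     | refl | refl = siblings
    siblingsSound (leaf u) (leaf v) p | inj₂ q with to (T-∧ {⌊ u ≟ b ⌋}) q
    ...   | ub , va with toWitness ub | toWitness va
    ...     | refl | refl = siblings′

    sound : ∀ t → T (isCherry t a b) → Cherry t a b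
    sound (node l r) p with to T-∨ p
    ... | inj₁ q = siblingsSound l r q
    ... | inj₂ q with to (T-∨ {isCherry l a b}) q
    ...   | inj₁ q′ = left (sound l q′)
    ...   | inj₂ q′ = right (sound r q′)

    complete : ∀ t → Cherry t a b → T (isCherry t a b)
    complete (node (leaf u) (leaf v)) siblings =
      from T-∨ (inj₁ (from T-∨ (inj₁ (from (T-∧ {⌊ u ≟ u ⌋}) (fromWitness refl , fromWitness refl)))))
    complete (node (leaf u) (leaf v)) siblings′ =
      from T-∨ (inj₁ (from (T-∨ {⌊ u ≟ v ⌋ ∧ ⌊ v ≟ u ⌋}) (inj₂ (from (T-∧ {⌊ u ≟ u ⌋}) (fromWitness refl , fromWitness refl)))))
    complete (node l r) (left c)  =
      from (T-∨ {siblingCherry l r a b}) (inj₂ (from T-∨ (inj₁ (complete l c))))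
    complete (node l r) (right c) =
      from (T-∨ {siblingCherry l r a b}) (inj₂ (from (T-∨ {isCherry l a b}) (inj₂ (complete r c))))

  data _∈ᵗ_ (a : Fin n) : Tree n → Set where
    leaf∈ : a ∈ᵗ leaf a
    ∈ˡ    : ∀ {l r} → a ∈ᵗ l → a ∈ᵗ node l r
    ∈ʳ    : ∀ {l r} → a ∈ᵗ r → a ∈ᵗ node l r

  Disjoint : Tree n → Tree n → Set
  Disjoint l r = ∀ {a} → a ∈ᵗ l → a ∈ᵗ r → ⊥

  Distinct : Tree n → Set
  Distinct (leaf _)   = ⊤
  Distinct (node l r) = Distinct l × Distinct r × Disjoint l r

  cherry-sym : ∀ {t a b} → Cherry t a b → Cherry t b a
  cherry-sym siblings  = siblings′
  cherry-sym siblings′ = siblings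
  cherry-sym (left c)  = left (cherry-sym c)
  cherry-sym (right c) = right (cherry-sym c)

  cherry-∈ᵗ : ∀ {t a b} → Cherry t a b → a ∈ᵗ t × b ∈ᵗ t
  cherry-∈ᵗ siblings  = ∈ˡ leaf∈ , ∈ʳ leaf∈
  cherry-∈ᵗ siblings′ = ∈ʳ leaf∈ , ∈ˡ leaf∈
  cherry-∈ᵗ (left c)  = let (p , q) = cherry-∈ᵗ c in ∈ˡ p , ∈ˡ q
  cherry-∈ᵗ (right c) = let (p , q) = cherry-∈ᵗ c in ∈ʳ p , ∈ʳ q

  cherry-≢ : ∀ {t a b} → Distinct t → Cherry t a b → a ≢ b
  cherry-≢ (_ , _ , disj) siblings  refl = disj leaf∈ leaf∈
  cherry-≢ (_ , _ , disj) siblings′ refl = disj leaf∈ leaf∈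
  cherry-≢ (dl , _ , _)   (left c)       = cherry-≢ dl c
  cherry-≢ (_ , dr , _)   (right c)      = cherry-≢ dr c

  cherry-unique : ∀ {t a b c} → Distinct t → Cherry t a b → Cherry t a c → b ≡ c
  cherry-unique _ siblings  siblings  = refl
  cherry-unique _ siblings  siblings′ = refl
  cherry-unique _ siblings′ siblings  = refl
  cherry-unique _ siblings′ siblings′ = refl
  cherry-unique (dl , _ , _) (left p)  (left q)  = cherry-unique dl p q
  cherry-unique (_ , dr , _) (right p) (right q) = cherry-unique dr p q
  cherry-unique (_ , _ , disj) (left p)  (right q) = ⊥-elim (disj (proj₁ (cherry-∈ᵗ p)) (proj₁ (cherry-∈ᵗ q)))
  cherry-unique (_ , _ , disj) (right p) (left q)  = ⊥-elim (disj (proj₁ (cherry-∈ᵗ q)) (proj₁ (cherry-∈ᵗ p)))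

  ∉[_] : ∀ {a b : Fin n} → a ≢ b → a ∉ [ b ]
  ∉[ a≢b ] (here a≡b) = a≢b a≡b

  delete-leaf∈ : ∀ {A a} → a ∈ A → deleteT A (leaf a) ≡ nothing
  delete-leaf∈ {A} {a} a∈A with a ∈? A
  ... | yes _  = refl
  ... | no a∉A = ⊥-elim (a∉A a∈A)

  delete-leaf∉ : ∀ {A a} → a ∉ A → deleteT A (leaf a) ≡ just (leaf a)
  delete-leaf∉ {A} {a} a∉A with a ∈? A
  ... | yes a∈A = ⊥-elim (a∉A a∈A)
  ... | no _    = refl

  delete-∈ᵗ : ∀ {A} t {t′ a} → deleteT A t ≡ just t′ → a ∈ᵗ t′ → a ∈ᵗ t × a ∉ A
  delete-∈ᵗ {A} (leaf b) e a∈ with b ∈? A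
  delete-∈ᵗ {A} (leaf b) refl leaf∈ | no b∉A = leaf∈ , b∉A
  delete-∈ᵗ {A} (node l r) e a∈ with deleteT A l in el | deleteT A r in er
  delete-∈ᵗ (node l r) refl a∈ | nothing | just r′ =
    let (p , q) = delete-∈ᵗ r er a∈ in ∈ʳ p , q
  delete-∈ᵗ (node l r) refl a∈ | just l′ | nothing =
    let (p , q) = delete-∈ᵗ l el a∈ in ∈ˡ p , q
  delete-∈ᵗ (node l r) refl (∈ˡ a∈) | just l′ | just r′ =
    let (p , q) = delete-∈ᵗ l el a∈ in ∈ˡ p , q
  delete-∈ᵗ (node l r) refl (∈ʳ a∈) | just l′ | just r′ =
    let (p , q) = delete-∈ᵗ r er a∈ in ∈ʳ p , q

  delete-distinct : ∀ {A} t {t′} → deleteT A t ≡ just t′ → Distinct t → Distinct t′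
  delete-distinct {A} (leaf b) e _ with b ∈? A
  delete-distinct (leaf b) refl _ | no _ = tt
  delete-distinct {A} (node l r) e d with deleteT A l in el | deleteT A r in er
  delete-distinct (node l r) refl (_ , dr , _) | nothing | just r′ = delete-distinct r er dr
  delete-distinct (node l r) refl (dl , _ , _) | just l′ | nothing = delete-distinct l el dl
  delete-distinct (node l r) refl (dl , dr , disj) | just l′ | just r′ =
    delete-distinct l el dl , delete-distinct r er dr ,
    λ p q → disj (proj₁ (delete-∈ᵗ l el p)) (proj₁ (delete-∈ᵗ r er q))

  delete-untouched : ∀ {A} t → (∀ {a} → a ∈ᵗ t → a ∉ A) → deleteT A t ≡ just t
  delete-untouched (leaf b)   avoid = delete-leaf∉ (avoid leaf∈)
  delete-untouched (node l r) avoid =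
    cong₂ join (delete-untouched l (avoid ∘ ∈ˡ)) (delete-untouched r (avoid ∘ ∈ʳ))

  delete-cherry : ∀ {A} t {x y} → Cherry t x y → x ∉ A → y ∉ A →
                  ∃[ t′ ] deleteT A t ≡ just t′ × Cherry t′ x y
  delete-cherry t@(node (leaf _) (leaf _)) siblings x∉ y∉ =
    t , cong₂ join (delete-leaf∉ x∉) (delete-leaf∉ y∉) , siblings
  delete-cherry t@(node (leaf _) (leaf _)) siblings′ x∉ y∉ =
    t , cong₂ join (delete-leaf∉ y∉) (delete-leaf∉ x∉) , siblings′
  delete-cherry {A} (node l r) (left c) x∉ y∉ with delete-cherry l c x∉ y∉
  ... | l′ , el , c′ with deleteT A r
  ...   | nothing = l′ , cong (λ m → join m nothing) el , c′
  ...   | just r′ = node l′ r′ , cong (λ m → join m (just r′)) el , left c′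
  delete-cherry {A} (node l r) (right c) x∉ y∉ with delete-cherry r c x∉ y∉
  ... | r′ , er , c′ with deleteT A l
  ...   | nothing = r′ , er , c′
  ...   | just l′ = node l′ r′ , cong (join (just l′)) er , right c′

  delete-keeps-cherry : ∀ {A} t {t′ a b} → deleteT A t ≡ just t′ → Cherry t a b → a ∉ A → b ∉ A → Cherry t′ a b
  delete-keeps-cherry t e c a∉ b∉ with delete-cherry t c a∉ b∉
  ... | t″ , e″ , c″ with trans (sym e″) e
  ...   | refl = c″

  delete-cong : ∀ {A B} → (∀ {a} → a ∈ A → a ∈ B) → (∀ {a} → a ∈ B → a ∈ A) →
                ∀ t → deleteT A t ≡ deleteT B t
  delete-cong {A} {B} A⊆B B⊆A (leaf a) with a ∈? A | a ∈? B
  ... | yes _   | yes _   = refl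
  ... | no _    | no _    = refl
  ... | yes a∈A | no a∉B  = ⊥-elim (a∉B (A⊆B a∈A))
  ... | no a∉A  | yes a∈B = ⊥-elim (a∉A (B⊆A a∈B))
  delete-cong A⊆B B⊆A (node l r) = cong₂ join (delete-cong A⊆B B⊆A l) (delete-cong A⊆B B⊆A r)

  delete-++ : ∀ A B t → deleteT (A ++ B) t ≡ (deleteT A t >>= deleteT B)
  delete-++ A B (leaf a) with a ∈? A
  ... | yes a∈A = delete-leaf∈ (∈-++⁺ˡ a∈A)
  ... | no a∉A with a ∈? B
  ...   | yes a∈B = delete-leaf∈ (∈-++⁺ʳ A a∈B)
  ...   | no a∉B  = delete-leaf∉ ([ a∉A , a∉B ]′ ∘ ∈-++⁻ A)
  delete-++ A B (node l r) =
    trans (cong₂ join (delete-++ A B l) (delete-++ A B r)) (sym (join->>= (deleteT A l) (deleteT A r)))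
    where
    join->>= : ∀ m₁ m₂ → (join m₁ m₂ >>= deleteT B) ≡ join (m₁ >>= deleteT B) (m₂ >>= deleteT B)
    join->>= nothing   m₂        = refl
    join->>= (just l′) nothing   with deleteT B l′
    ... | nothing = refl
    ... | just _  = refl
    join->>= (just l′) (just r′) = refl

module _ {n : ℕ} where

  rename : (Fin n → Fin n) → Tree n → Tree n
  rename σ (leaf a)   = leaf (σ a)
  rename σ (node l r) = node (rename σ l) (rename σ r)

  rename-cherry : ∀ σ {t a b} → Cherry t a b → Cherry (rename σ t) (σ a) (σ b)
  rename-cherry σ siblings  = siblings
  rename-cherry σ siblings′ = siblings′
  rename-cherry σ (left c)  = left (rename-cherry σ c)
  rename-cherry σ (right c) = right (rename-cherry σ c)

  rename-cherry⁻ : ∀ σ t {a′ b′} → Cherry (rename σ t) a′ b′ →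
                   ∃[ a ] ∃[ b ] σ a ≡ a′ × σ b ≡ b′ × Cherry t a b
  rename-cherry⁻ σ (node (leaf u) (leaf v)) siblings  = u , v , refl , refl , siblings
  rename-cherry⁻ σ (node (leaf u) (leaf v)) siblings′ = v , u , refl , refl , siblings′
  rename-cherry⁻ σ (node l r) (left c) =
    let (a , b , σa , σb , c′) = rename-cherry⁻ σ l c in a , b , σa , σb , left c′
  rename-cherry⁻ σ (node l r) (right c) =
    let (a , b , σa , σb , c′) = rename-cherry⁻ σ r c in a , b , σa , σb , right c′

  rename-cherry⇔ : ∀ {σ} → Injective _≡_ _≡_ σ → ∀ t {a b} → Cherry (rename σ t) (σ a) (σ b) ⇔ Cherry t a b
  rename-cherry⇔ {σ} σ-inj t = mk⇔ back (rename-cherry σ)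
    where
    back : ∀ {a b} → Cherry (rename σ t) (σ a) (σ b) → Cherry t a b
    back c with rename-cherry⁻ σ t c
    ... | _ , _ , σa , σb , c′ with σ-inj σa | σ-inj σb
    ...   | refl | refl = c′

  rename-fixed : ∀ σ t → (∀ {a} → a ∈ᵗ t → σ a ≡ a) → rename σ t ≡ t
  rename-fixed σ (leaf a)   fix = cong leaf (fix leaf∈)
  rename-fixed σ (node l r) fix = cong₂ node (rename-fixed σ l (fix ∘ ∈ˡ)) (rename-fixed σ r (fix ∘ ∈ʳ))

  rename-join : ∀ σ (m₁ m₂ : Maybe (Tree n)) →
                Maybe.map (rename σ) (join m₁ m₂) ≡ join (Maybe.map (rename σ) m₁) (Maybe.map (rename σ) m₂)
  rename-join σ nothing  m₂       = refl
  rename-join σ (just _) nothing  = refl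
  rename-join σ (just _) (just _) = refl

module _ {n : ℕ} where

  neighbour : Forest n → Fin n → Fin n → Bool
  neighbour G z b = any (λ t → isCherry t b z) G

  w-count : ∀ G z → w G z ≡ + count (neighbour G z) - 1ℤ
  w-count G z = cong (λ k → + k - 1ℤ) (∣tabulate∣≡count (neighbour G z))

  neighbour⁺ : ∀ {G t z b} → t ∈ G → Cherry t z b → neighbour G z b ≡ true
  neighbour⁺ {G} {z = z} {b} t∈G zb =
    to T-≡ (any⁺ _ (Any.map (λ { refl → from (cherry⇔ _ b z) (cherry-sym zb) }) t∈G))

  neighbour⁻ : ∀ {G z b} → neighbour G z b ≡ true → Any (λ t → Cherry t z b) G
  neighbour⁻ {G} {z} {b} e = Any.map (λ {t} c → cherry-sym (to (cherry⇔ t b z) c)) (any⁻ _ G (from T-≡ e))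

  rename-InH : ∀ (σ : Fin n → Fin n) {G z} → InH G z → InH (map (rename σ) G) (σ z)
  rename-InH σ {[]}             []                = []
  rename-InH σ {t ∷ G} {z} ((b , zb) ∷ rest) =
    (σ b , from (cherry⇔ _ (σ z) (σ b)) (rename-cherry σ (to (cherry⇔ t z b) zb))) ∷ rename-InH σ rest

  rename-CherryIn : ∀ (σ : Fin n → Fin n) {G a b} → CherryIn G a b → CherryIn (map (rename σ) G) (σ a) (σ b)
  rename-CherryIn σ {t ∷ _} {a} {b} (here ab) =
    here (from (cherry⇔ _ (σ a) (σ b)) (rename-cherry σ (to (cherry⇔ t a b) ab)))
  rename-CherryIn σ {_ ∷ _} (there ab) = there (rename-CherryIn σ ab)

  rename-neighbour : ∀ {σ} → Injective _≡_ _≡_ σ → ∀ G z b →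
                     neighbour (map (rename σ) G) (σ z) (σ b) ≡ neighbour G z b
  rename-neighbour σ-inj []      z b = refl
  rename-neighbour {σ} σ-inj (t ∷ G) z b = cong₂ _∨_
    (T-injective (from (cherry⇔ t b z) ∘ to (rename-cherry⇔ σ-inj t) ∘ to (cherry⇔ _ (σ b) (σ z)))
                 (from (cherry⇔ _ (σ b) (σ z)) ∘ from (rename-cherry⇔ σ-inj t) ∘ to (cherry⇔ t b z)))
    (rename-neighbour σ-inj G z b)

  transpose-w : ∀ {x y} → x ≢ y → ∀ G z → w (map (rename (transpose x y)) G) (transpose x y z) ≡ w G z
  transpose-w {x} {y} x≢y G z = begin
    w (map (rename σ) G) (σ z)                                 ≡⟨ w-count (map (rename σ) G) (σ z) ⟩
    + count (neighbour (map (rename σ) G) (σ z)) - 1ℤ          ≡⟨ cong (λ k → + k - 1ℤ) counts ⟩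
    + count (neighbour G z) - 1ℤ                               ≡⟨ sym (w-count G z) ⟩
    w G z                                                      ∎
    where
    open ≡-Reasoning
    σ : Fin n → Fin n
    σ = transpose x y
    counts : count (neighbour (map (rename σ) G) (σ z)) ≡ count (neighbour G z)
    counts = trans (sym (count-transpose x y (neighbour (map (rename σ) G) (σ z)) x≢y))
                   (count-cong (rename-neighbour (transpose-injective x y) G z))

module CherryPair {n : ℕ} (x y : Fin n) where

  partner-≢ : ∀ {t z b} → Distinct t → Cherry t x y → Cherry t z b → z ≢ y → b ≢ x
  partner-≢ d xy zb z≢y refl = z≢y (cherry-unique d (cherry-sym zb) xy)

  -- u′ arises from u by contracting a cherry into the leaf y: a leaf u′ is
  -- the leaf y, and cherries of u′ avoiding y are cherries of u.
  Contraction : Tree n → Tree n → Set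
  Contraction u u′ = (∀ {c} → u′ ≡ leaf c → c ≡ y)
                   × (∀ {z b} → Cherry u′ z b → z ≢ y → b ≢ y → Cherry u z b)

  contraction-left : ∀ {l l′} r → Contraction l l′ → Contraction (node l r) (node l′ r)
  contraction-left {l} {l′} r (is-y , back) = (λ ()) , back′
    where
    back′ : ∀ {z b} → Cherry (node l′ r) z b → z ≢ y → b ≢ y → Cherry (node l r) z b
    back′ siblings  z≢y b≢y = ⊥-elim (z≢y (is-y refl))
    back′ siblings′ z≢y b≢y = ⊥-elim (b≢y (is-y refl))
    back′ (left c)  z≢y b≢y = left (back c z≢y b≢y)
    back′ (right c) z≢y b≢y = right c

  contraction-right : ∀ l {r r′} → Contraction r r′ → Contraction (node l r) (node l r′)
  contraction-right l {r} {r′} (is-y , back) = (λ ()) , back′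
    where
    back′ : ∀ {z b} → Cherry (node l r′) z b → z ≢ y → b ≢ y → Cherry (node l r) z b
    back′ siblings  z≢y b≢y = ⊥-elim (b≢y (is-y refl))
    back′ siblings′ z≢y b≢y = ⊥-elim (z≢y (is-y refl))
    back′ (left c)  z≢y b≢y = left c
    back′ (right c) z≢y b≢y = right (back c z≢y b≢y)

  delete-x : ∀ u → Distinct u → Cherry u x y → ∃[ u′ ] deleteT [ x ] u ≡ just u′ × Contraction u u′
  delete-x (node (leaf _) (leaf _)) d siblings =
    leaf y , cong₂ join (delete-leaf∈ {A = [ x ]} (here refl)) (delete-leaf∉ ∉[ cherry-≢ d siblings′ ]) ,
    (λ { refl → refl }) , λ ()
  delete-x (node (leaf _) (leaf _)) d siblings′ =
    leaf y , cong₂ join (delete-leaf∉ ∉[ cherry-≢ d siblings ]) (delete-leaf∈ {A = [ x ]} (here refl)) ,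
    (λ { refl → refl }) , λ ()
  delete-x (node l r) (dl , dr , disj) (left c) =
    let (l′ , el , con) = delete-x l dl c
        x∉r = λ x∈r → disj (proj₁ (cherry-∈ᵗ c)) x∈r
    in node l′ r , cong₂ join el (delete-untouched {A = [ x ]} r λ { a∈r (here refl) → x∉r a∈r }) ,
       contraction-left r con
  delete-x (node l r) (dl , dr , disj) (right c) =
    let (r′ , er , con) = delete-x r dr c
        x∉l = λ x∈l → disj x∈l (proj₁ (cherry-∈ᵗ c))
    in node l r′ , cong₂ join (delete-untouched {A = [ x ]} l λ { a∈l (here refl) → x∉l a∈l }) er ,
       contraction-right l con

  KeepsCherries : Tree n → Tree n → Set
  KeepsCherries u u′ = ∀ {z b₀} → z ≢ x → z ≢ y → Cherry u z b₀ → ∀ {b} → Cherry u z b ⇔ Cherry u′ z b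

  delete-x-keeps : ∀ u → Distinct u → Cherry u x y → ∃[ u′ ] deleteT [ x ] u ≡ just u′ × KeepsCherries u u′
  delete-x-keeps u d xy with delete-x u d xy
  ... | u′ , e , is-y , back = u′ , e , keeps
    where
    survives : ∀ {z b} → z ≢ x → z ≢ y → Cherry u z b → Cherry u′ z b
    survives z≢x z≢y zb = delete-keeps-cherry u e zb ∉[ z≢x ] ∉[ partner-≢ d xy zb z≢y ]

    keeps : KeepsCherries u u′
    keeps {z} {b₀} z≢x z≢y zb₀ {b} = mk⇔ (survives z≢x z≢y) restore
      where
      restore : Cherry u′ z b → Cherry u z b
      restore zb with b ≟ y
      ... | no b≢y  = back zb z≢y b≢y
      ... | yes refl with cherry-unique (delete-distinct u e d) (survives z≢x z≢y zb₀) zb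
      ...   | refl = ⊥-elim (z≢x (cherry-unique d (cherry-sym zb₀) (cherry-sym xy)))

  Avoids : Tree n → Set
  Avoids t = ∀ {a} → a ∈ᵗ t → a ≢ x × a ≢ y

  avoids-right : ∀ {l r} → Disjoint l r → Cherry l x y → Avoids r
  avoids-right disj c a∈r =
    (λ { refl → disj (proj₁ (cherry-∈ᵗ c)) a∈r }) , (λ { refl → disj (proj₂ (cherry-∈ᵗ c)) a∈r })

  avoids-left : ∀ {l r} → Disjoint l r → Cherry r x y → Avoids l
  avoids-left disj c a∈l =
    (λ { refl → disj a∈l (proj₁ (cherry-∈ᵗ c)) }) , (λ { refl → disj a∈l (proj₂ (cherry-∈ᵗ c)) })

  avoids-delete-x : ∀ t → Avoids t → deleteT [ x ] t ≡ just t
  avoids-delete-x t av = delete-untouched t (λ { a∈t (here refl) → proj₁ (av a∈t) refl })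

  avoids-delete-y : ∀ t → Avoids t → deleteT [ y ] t ≡ just t
  avoids-delete-y t av = delete-untouched t (λ { a∈t (here refl) → proj₂ (av a∈t) refl })

  avoids-rename : ∀ t → Avoids t → rename (transpose x y) t ≡ t
  avoids-rename t av = rename-fixed (transpose x y) t (λ a∈t → transpose-other x y (proj₁ (av a∈t)) (proj₂ (av a∈t)))

  delete-x≡rename-delete-y : ∀ u → Distinct u → Cherry u x y →
    deleteT [ x ] u ≡ Maybe.map (rename (transpose x y)) (deleteT [ y ] u)
  delete-x≡rename-delete-y (node (leaf _) (leaf _)) d siblings = begin
    join (deleteT [ x ] (leaf x)) (deleteT [ x ] (leaf y))
      ≡⟨ cong₂ join (delete-leaf∈ {A = [ x ]} (here refl)) (delete-leaf∉ ∉[ cherry-≢ d siblings′ ]) ⟩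
    just (leaf y)
      ≡⟨ cong (just ∘ leaf) (sym (transpose-x x y)) ⟩
    Maybe.map σ (just (leaf x))
      ≡⟨ cong (Maybe.map σ) (cong₂ join (sym (delete-leaf∉ ∉[ cherry-≢ d siblings ])) (sym (delete-leaf∈ {A = [ y ]} (here refl)))) ⟩
    Maybe.map σ (join (deleteT [ y ] (leaf x)) (deleteT [ y ] (leaf y))) ∎
    where
    open ≡-Reasoning
    σ : Tree n → Tree n
    σ = rename (transpose x y)
  delete-x≡rename-delete-y (node (leaf _) (leaf _)) d siblings′ = begin
    join (deleteT [ x ] (leaf y)) (deleteT [ x ] (leaf x))
      ≡⟨ cong₂ join (delete-leaf∉ ∉[ cherry-≢ d siblings ]) (delete-leaf∈ {A = [ x ]} (here refl)) ⟩
    just (leaf y)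
      ≡⟨ cong (just ∘ leaf) (sym (transpose-x x y)) ⟩
    Maybe.map σ (just (leaf x))
      ≡⟨ cong (Maybe.map σ) (cong₂ join (sym (delete-leaf∈ {A = [ y ]} (here refl))) (sym (delete-leaf∉ ∉[ cherry-≢ d siblings′ ]))) ⟩
    Maybe.map σ (join (deleteT [ y ] (leaf y)) (deleteT [ y ] (leaf x))) ∎
    where
    open ≡-Reasoning
    σ : Tree n → Tree n
    σ = rename (transpose x y)
  delete-x≡rename-delete-y (node l r) (dl , dr , disj) (left c) = begin
    join (deleteT [ x ] l) (deleteT [ x ] r)
      ≡⟨ cong₂ join (delete-x≡rename-delete-y l dl c) (avoids-delete-x r av) ⟩
    join (Maybe.map σ (deleteT [ y ] l)) (just r)
      ≡⟨ cong (join (Maybe.map σ (deleteT [ y ] l)) ∘ just) (sym (avoids-rename r av)) ⟩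
    join (Maybe.map σ (deleteT [ y ] l)) (Maybe.map σ (just r))
      ≡⟨ sym (rename-join (transpose x y) (deleteT [ y ] l) (just r)) ⟩
    Maybe.map σ (join (deleteT [ y ] l) (just r))
      ≡⟨ cong (Maybe.map σ ∘ join (deleteT [ y ] l)) (sym (avoids-delete-y r av)) ⟩
    Maybe.map σ (join (deleteT [ y ] l) (deleteT [ y ] r)) ∎
    where
    open ≡-Reasoning
    σ : Tree n → Tree n
    σ = rename (transpose x y)
    av : Avoids r
    av = avoids-right disj c
  delete-x≡rename-delete-y (node l r) (dl , dr , disj) (right c) = begin
    join (deleteT [ x ] l) (deleteT [ x ] r)
      ≡⟨ cong₂ join (avoids-delete-x l av) (delete-x≡rename-delete-y r dr c) ⟩
    join (just l) (Maybe.map σ (deleteT [ y ] r))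
      ≡⟨ cong (λ l′ → join (just l′) (Maybe.map σ (deleteT [ y ] r))) (sym (avoids-rename l av)) ⟩
    join (Maybe.map σ (just l)) (Maybe.map σ (deleteT [ y ] r))
      ≡⟨ sym (rename-join (transpose x y) (just l) (deleteT [ y ] r)) ⟩
    Maybe.map σ (join (just l) (deleteT [ y ] r))
      ≡⟨ cong (λ m → Maybe.map σ (join m (deleteT [ y ] r))) (sym (avoids-delete-y l av)) ⟩
    Maybe.map σ (join (deleteT [ y ] l) (deleteT [ y ] r)) ∎
    where
    open ≡-Reasoning
    σ : Tree n → Tree n
    σ = rename (transpose x y)
    av : Avoids l
    av = avoids-left disj c

  Paired : Tree n → Set
  Paired t = Distinct t × Cherry t x y

  paired-≢ : ∀ {G} → G ≢ [] → All Paired G → x ≢ y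
  paired-≢ {[]}    G≢[] _             = ⊥-elim (G≢[] refl)
  paired-≢ {_ ∷ _} _    ((d , xy) ∷ _) = cherry-≢ d xy

  -- In a nonempty forest of such trees, x has the single neighbour y, so w(x) = 0.
  w-paired : ∀ {G} → G ≢ [] → All Paired G → w G x ≡ 0ℤ
  w-paired {[]}    G≢[] _ = ⊥-elim (G≢[] refl)
  w-paired {t ∷ G} _ paired@((_ , xy) ∷ _) = begin
    w (t ∷ G) x                        ≡⟨ w-count (t ∷ G) x ⟩
    + count (neighbour (t ∷ G) x) - 1ℤ ≡⟨ cong (λ k → + k - 1ℤ) single ⟩
    0ℤ                                 ∎
    where
    open ≡-Reasoning
    only-y : ∀ {G′} → All Paired G′ → ∀ {b} → Any (λ t → Cherry t x b) G′ → b ≡ y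
    only-y ((d , xy′) ∷ _) (here xb)  = cherry-unique d xb xy′
    only-y (_ ∷ ps)        (there xb) = only-y ps xb
    single : count (neighbour (t ∷ G) x) ≡ 1
    single = count-single (neighbour (t ∷ G) x) y (neighbour⁺ {G = t ∷ G} (here refl) xy)
               (λ b e → only-y paired (neighbour⁻ e))

  delete-paired : ∀ {D} G → x ∉ D → y ∉ D → All Paired G → Pointwise (λ _ → Paired) G (G ∖ D)
  delete-paired {D} G x∉ y∉ ps = mapMaybe-pointwise (All.map survive ps)
    where
    survive : ∀ {t} → Paired t → ∃[ t′ ] deleteT D t ≡ just t′ × Paired t′
    survive {t} (d , xy) with delete-cherry t xy x∉ y∉
    ... | t′ , e , xy′ = t′ , e , delete-distinct t e d , xy′

  delete-x-forest : ∀ G → All Paired G → Pointwise KeepsCherries G (G ∖ [ x ])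
  delete-x-forest G ps = mapMaybe-pointwise (All.map (λ {t} (d , xy) → delete-x-keeps t d xy) ps)

  module _ {u u′ : Tree n} (keeps : KeepsCherries u u′) {z b₀ : Fin n} (z≢x : z ≢ x) (z≢y : z ≢ y)
           (zb₀ : CherryOf u z b₀) where

    keeps-CherryOf : ∀ {b} → CherryOf u z b → CherryOf u′ z b
    keeps-CherryOf {b} = from (cherry⇔ u′ z b) ∘ to (keeps z≢x z≢y (to (cherry⇔ u z b₀) zb₀)) ∘ to (cherry⇔ u z b)

    keeps-isCherry : ∀ b → isCherry u b z ≡ isCherry u′ b z
    keeps-isCherry b = T-injective (flipped (to same)) (flipped (from same))
      where
      same : Cherry u z b ⇔ Cherry u′ z b
      same = keeps z≢x z≢y (to (cherry⇔ u z b₀) zb₀)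
      flipped : ∀ {t t′} → (Cherry t z b → Cherry t′ z b) → CherryOf t b z → CherryOf t′ b z
      flipped {t} {t′} f = from (cherry⇔ t′ b z) ∘ cherry-sym ∘ f ∘ cherry-sym ∘ to (cherry⇔ t b z)

  module _ {z : Fin n} (z≢x : z ≢ x) (z≢y : z ≢ y) where

    keeps-InH : ∀ {G G′} → Pointwise KeepsCherries G G′ → InH G z → InH G′ z
    keeps-InH []       []                 = []
    keeps-InH (k ∷ ks) ((b , zb) ∷ rest) = (b , keeps-CherryOf k z≢x z≢y zb zb) ∷ keeps-InH ks rest

    keeps-neighbour : ∀ {G G′} → Pointwise KeepsCherries G G′ → InH G z → ∀ b → neighbour G z b ≡ neighbour G′ z b
    keeps-neighbour []       []                  b = refl
    keeps-neighbour (k ∷ ks) ((b₀ , zb₀) ∷ rest) b =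
      cong₂ _∨_ (keeps-isCherry k z≢x z≢y zb₀ b) (keeps-neighbour ks rest b)

    keeps-w : ∀ {G G′} → Pointwise KeepsCherries G G′ → InH G z → w G z ≡ w G′ z
    keeps-w {G} {G′} ks h = begin
      w G z                          ≡⟨ w-count G z ⟩
      + count (neighbour G z) - 1ℤ   ≡⟨ cong (λ k → + k - 1ℤ) (count-cong (keeps-neighbour ks h)) ⟩
      + count (neighbour G′ z) - 1ℤ  ≡⟨ sym (w-count G′ z) ⟩
      w G′ z                         ∎
      where open ≡-Reasoning

    keeps-CherryIn : ∀ {G G′ b} → Pointwise KeepsCherries G G′ → CherryIn G z b → CherryIn G′ z b
    keeps-CherryIn (k ∷ _)  (here zb)  = here (keeps-CherryOf k z≢x z≢y zb zb)
    keeps-CherryIn (_ ∷ ks) (there zb) = there (keeps-CherryIn ks zb)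

  delete-x≡rename-delete-y-forest : ∀ G → All Paired G → G ∖ [ x ] ≡ map (rename (transpose x y)) (G ∖ [ y ])
  delete-x≡rename-delete-y-forest G ps = trans
    (mapMaybe-cong-All (All.map (λ {t} (d , xy) → delete-x≡rename-delete-y t d xy) ps))
    (sym (map-mapMaybe (rename (transpose x y)) (deleteT [ y ]) G))

module _ {n : ℕ} where

  ∈ᵗ⇒∈leaves : ∀ {a : Fin n} {t} → a ∈ᵗ t → a ∈ leaves t
  ∈ᵗ⇒∈leaves leaf∈                = here refl
  ∈ᵗ⇒∈leaves (∈ˡ {l} {r} a∈l) = ∈-++⁺ˡ (∈ᵗ⇒∈leaves a∈l)
  ∈ᵗ⇒∈leaves (∈ʳ {l} {r} a∈r) = ∈-++⁺ʳ (leaves l) (∈ᵗ⇒∈leaves a∈r)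

  unique⇒distinct : ∀ (t : Tree n) → Unique (leaves t) → Distinct t
  unique⇒distinct (leaf _)   _ = _
  unique⇒distinct (node l r) u with unique-++ (leaves l) u
  ... | ul , ur , disj = unique⇒distinct l ul , unique⇒distinct r ur ,
                         λ a∈l a∈r → disj (∈ᵗ⇒∈leaves a∈l) (∈ᵗ⇒∈leaves a∈r)

  phylo⇒distinct : ∀ {t} → IsPhyloTree n t → Distinct t
  phylo⇒distinct {t} p = unique⇒distinct t (Unique-resp-↭ (setoid (Fin n)) (↭⇒↭ₛ (↭-sym p)) (allFin⁺ n))

  pred≡0 : ∀ k → + k - 1ℤ ≡ 0ℤ → k ≡ 1
  pred≡0 (suc zero) _ = refl

  common-partner : ∀ {G : Forest n} {x} → G ≢ [] → All Distinct G → InH G x → w G x ≡ 0ℤ →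
                   ∃[ y ] All (CherryPair.Paired x y) G
  common-partner {[]}     G≢[] _  _ _  = ⊥-elim (G≢[] refl)
  common-partner {t₀ ∷ G} {x} _ ds hx@((y , xy) ∷ _) w≡0 = y , All.tabulate paired
    where
    one : count (neighbour (t₀ ∷ G) x) ≡ 1
    one = pred≡0 _ (trans (sym (w-count (t₀ ∷ G) x)) w≡0)
    y-neighbour : neighbour (t₀ ∷ G) x y ≡ true
    y-neighbour = neighbour⁺ {G = t₀ ∷ G} (here refl) (to (cherry⇔ t₀ x y) xy)
    paired : ∀ {t} → t ∈ t₀ ∷ G → CherryPair.Paired x y t
    paired {t} t∈G with All.lookup hx t∈G
    ... | b , xb = All.lookup ds t∈G , subst (Cherry t x) b≡y (to (cherry⇔ t x b) xb)
      where
      b≡y : b ≡ y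
      b≡y = count≡1-unique (neighbour (t₀ ∷ G) x) one
              (neighbour⁺ {G = t₀ ∷ G} t∈G (to (cherry⇔ t x b) xb)) y-neighbour

module _ {n : ℕ} (Ts : Forest n) where

  ∖-resp-↭ : ∀ {A B : List (Fin n)} → A ↭ B → Ts ∖ A ≡ Ts ∖ B
  ∖-resp-↭ A↭B = mapMaybe-cong (delete-cong (∈-resp-↭ A↭B) (∈-resp-↭ (↭-sym A↭B))) Ts

  ∖-∷ : ∀ x D → Ts ∖ (x ∷ D) ≡ (Ts ∖ D) ∖ [ x ]
  ∖-∷ x D = begin
    Ts ∖ (x ∷ D)                                   ≡⟨ ∖-resp-↭ (++-comm [ x ] D) ⟩
    mapMaybe (deleteT (D ++ [ x ])) Ts             ≡⟨ mapMaybe-cong (delete-++ D [ x ]) Ts ⟩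
    mapMaybe (λ t → deleteT D t >>= deleteT [ x ]) Ts ≡⟨ mapMaybe->>= (deleteT D) (deleteT [ x ]) Ts ⟩
    (Ts ∖ D) ∖ [ x ]                               ∎
    where open ≡-Reasoning

  CPSteps-∷ : ∀ D p {l} → l ≢ [] → CPSteps Ts D (p ∷ l) ⇔ (InH (Ts ∖ D) p × CPSteps Ts (D ++ [ p ]) l)
  CPSteps-∷ D p {[]}    l≢[] = ⊥-elim (l≢[] refl)
  CPSteps-∷ D p {_ ∷ _} _    = mk⇔ (λ c → c) (λ c → c)

  weightFrom-∷ : ∀ D p {l} → l ≢ [] → weightFrom Ts D (p ∷ l) ≡ w (Ts ∖ D) p ℤ.+ weightFrom Ts (D ++ [ p ]) l
  weightFrom-∷ D p {[]}    l≢[] = ⊥-elim (l≢[] refl)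
  weightFrom-∷ D p {_ ∷ _} _    = refl

  Replaces : List (Fin n) → List (Fin n) → List (Fin n) → List (Fin n) → Set
  Replaces D l D′ l′ = CPSteps Ts D l → CPSteps Ts D′ l′ × (weightFrom Ts D l ≡ weightFrom Ts D′ l′)

  replaces-trans : ∀ {D₁ l₁ D₂ l₂ D₃ l₃} → Replaces D₁ l₁ D₂ l₂ → Replaces D₂ l₂ D₃ l₃ → Replaces D₁ l₁ D₃ l₃
  replaces-trans r₁₂ r₂₃ c₁ with r₁₂ c₁
  ... | c₂ , w₁₂ with r₂₃ c₂
  ...   | c₃ , w₂₃ = c₃ , trans w₁₂ w₂₃

  replaces-↭ : ∀ {A B} l → A ↭ B → Replaces A l B l
  replaces-↭ []          A↭B _       = tt , refl
  replaces-↭ (_ ∷ [])    A↭B _       = tt , refl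
  replaces-↭ (p ∷ q ∷ l) A↭B (h , c) with replaces-↭ (q ∷ l) (++⁺ʳ [ p ] A↭B) c
  ... | c′ , wl = (subst (λ G → InH G p) (∖-resp-↭ A↭B) h , c′) ,
                  cong₂ ℤ._+_ (cong (λ G → w G p) (∖-resp-↭ A↭B)) wl

  replaces-∷ : ∀ {D D′ p p′ l l′} → l ≢ [] → l′ ≢ [] →
    (InH (Ts ∖ D) p → InH (Ts ∖ D′) p′ × (w (Ts ∖ D) p ≡ w (Ts ∖ D′) p′)) →
    Replaces (D ++ [ p ]) l (D′ ++ [ p′ ]) l′ → Replaces D (p ∷ l) D′ (p′ ∷ l′)
  replaces-∷ {D} {D′} {p} {p′} {l} {l′} l≢[] l′≢[] head rest c with to (CPSteps-∷ D p l≢[]) c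
  ... | h , cl with head h | rest cl
  ...   | h′ , wp | cl′ , wl =
    from (CPSteps-∷ D′ p′ l′≢[]) (h′ , cl′) ,
    trans (weightFrom-∷ D p l≢[]) (trans (cong₂ ℤ._+_ wp wl) (sym (weightFrom-∷ D′ p′ l′≢[])))

  replaces-prefix : ∀ P D {u l u′ l′} → Replaces (D ++ P) (u ∷ l) (D ++ P) (u′ ∷ l′) →
                    Replaces D (P ++ u ∷ l) D (P ++ u′ ∷ l′)
  replaces-prefix []      D r = replaces-trans (replaces-↭ _ (↭-reflexive (sym (++-identityʳ D))))
                                  (replaces-trans r (replaces-↭ _ (↭-reflexive (++-identityʳ D))))
  replaces-prefix (p ∷ P) D r =
    replaces-∷ (++-≢[] P (λ ())) (++-≢[] P (λ ())) (λ h → h , refl)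
      (replaces-prefix P (D ++ [ p ]) (replaces-trans (replaces-↭ _ (↭-reflexive (++-assoc D [ p ] P)))
        (replaces-trans r (replaces-↭ _ (↭-reflexive (sym (++-assoc D [ p ] P)))))))

  CPSteps-at : ∀ D pre a {post} → post ≢ [] → CPSteps Ts D (pre ++ a ∷ post) → InH (Ts ∖ (D ++ pre)) a
  CPSteps-at D []        a post≢[] c =
    subst (λ E → InH (Ts ∖ E) a) (sym (++-identityʳ D)) (proj₁ (to (CPSteps-∷ D a post≢[]) c))
  CPSteps-at D (p ∷ pre) a post≢[] c =
    subst (λ E → InH (Ts ∖ E) a) (++-assoc D [ p ] pre)
      (CPSteps-at (D ++ [ p ]) pre a post≢[] (proj₂ (to (CPSteps-∷ D p (++-≢[] pre (λ ()))) c)))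

  ∖-absent : ∀ D → All (λ t → ∀ {a} → a ∈ᵗ t → a ∉ D) (Ts ∖ D)
  ∖-absent D = AllP.mapMaybe⁺ {f = deleteT D} (AllP.map⁺ {xs = Ts} (All.tabulate (λ {t} _ → absent t)))
    where
    absent : ∀ t → MaybeAll.All (λ t′ → ∀ {a} → a ∈ᵗ t′ → a ∉ D) (deleteT D t)
    absent t with deleteT D t in e
    ... | nothing = MaybeAll.nothing
    ... | just t′ = MaybeAll.just (λ a∈t′ → proj₂ (delete-∈ᵗ t e a∈t′))

  ∖-partner∉ : ∀ D {a b} → CherryIn (Ts ∖ D) a b → b ∉ D
  ∖-partner∉ D = go (∖-absent D)
    where
    go : ∀ {G a b} → All (λ t → ∀ {c} → c ∈ᵗ t → c ∉ D) G → CherryIn G a b → b ∉ D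
    go {t ∷ _} {a} {b} (abs ∷ _) (here ab) = abs (proj₂ (cherry-∈ᵗ (to (cherry⇔ t a b) ab)))
    go (_ ∷ abss) (there ab) = go abss ab

  Realised : List (Fin n) → Fin n → Fin n → Set
  Realised s a b = ∃[ pre ] ∃[ post ] (s ≡ pre ++ (a ∷ post))
                   × CherryIn (Ts ∖ pre) a b × (w (Ts ∖ pre) a > 0ℤ)

  satisfies-transfer : ∀ {s s′ x} C → (∀ {a b} → a ≢ x → b ≢ x → Realised s a b → Realised s′ a b) →
                       x ∉ π₁ C → x ∉ π₂ C → Satisfies Ts C s → Satisfies Ts C s′
  satisfies-transfer []      _    _   _   []         = []
  satisfies-transfer (_ ∷ C) move x∉₁ x∉₂ (r ∷ rs) =
    move (λ { refl → x∉₁ (here refl) }) (λ { refl → x∉₂ (here refl) }) r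
    ∷ satisfies-transfer C move (x∉₁ ∘ there) (x∉₂ ∘ there) rs

module Exchange {n : ℕ} (Ts : Forest n) (Ts≢[] : Ts ≢ []) (x y : Fin n)
                (paired : All (CherryPair.Paired x y) Ts) where
  open CherryPair x y

  σ : Fin n → Fin n
  σ = transpose x y

  x≢y : x ≢ y
  x≢y = paired-≢ Ts≢[] paired

  Fresh : List (Fin n) → Set
  Fresh D = All (λ p → p ≢ x × p ≢ y) D

  fresh-x∉ : ∀ {D} → Fresh D → x ∉ D
  fresh-x∉ fD x∈D = proj₁ (All.lookup fD x∈D) refl

  fresh-y∉ : ∀ {D} → Fresh D → y ∉ D
  fresh-y∉ fD y∈D = proj₂ (All.lookup fD y∈D) refl

  fresh : ∀ {D} → x ∉ D → y ∉ D → Fresh D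
  fresh x∉D y∉D = All.tabulate (λ p∈D → (λ { refl → x∉D p∈D }) , (λ { refl → y∉D p∈D }))

  fresh-snoc : ∀ {D p} → Fresh D → p ≢ x → p ≢ y → Fresh (D ++ [ p ])
  fresh-snoc fD p≢x p≢y = AllP.++⁺ fD ((p≢x , p≢y) ∷ [])

  fresh-around : ∀ P Q R → Unique (P ++ y ∷ (Q ++ x ∷ R)) → Fresh P × Fresh Q
  fresh-around P Q R unique with unique-++ P unique
  ... | _ , (_ ∷ unique-Q) , disjoint =
    fresh (λ x∈P → disjoint x∈P (there (∈-++⁺ʳ Q (here refl)))) (proj₁ (unique-middle P unique)) ,
    fresh (proj₁ (unique-middle Q unique-Q)) (λ y∈Q → proj₂ (unique-middle P unique) (∈-++⁺ˡ y∈Q))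

  module _ {D : List (Fin n)} (fD : Fresh D) where

    paired-after : All Paired (Ts ∖ D)
    paired-after = pointwise-All (λ p → p) (delete-paired Ts (fresh-x∉ fD) (fresh-y∉ fD) paired)

    nonempty-after : Ts ∖ D ≢ []
    nonempty-after = pointwise-≢[] (delete-paired Ts (fresh-x∉ fD) (fresh-y∉ fD) paired) Ts≢[]

    x-in-H-after : InH (Ts ∖ D) x
    x-in-H-after = All.map (λ {t} (_ , xy) → y , from (cherry⇔ t x y) xy) paired-after

    w-x-after : w (Ts ∖ D) x ≡ 0ℤ
    w-x-after = w-paired nonempty-after paired-after

    w-y-after : w (Ts ∖ D) y ≡ 0ℤ
    w-y-after = CherryPair.w-paired y x nonempty-after (All.map (λ (d , xy) → d , cherry-sym xy) paired-after)

    pick-x-H : ∀ {z} → z ≢ x → z ≢ y → InH (Ts ∖ D) z →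
               InH (Ts ∖ (x ∷ D)) z × (w (Ts ∖ D) z ≡ w (Ts ∖ (x ∷ D)) z)
    pick-x-H z≢x z≢y h rewrite ∖-∷ Ts x D =
      keeps-InH z≢x z≢y keeps h , keeps-w z≢x z≢y keeps h
      where
      keeps : Pointwise KeepsCherries (Ts ∖ D) ((Ts ∖ D) ∖ [ x ])
      keeps = delete-x-forest (Ts ∖ D) paired-after

    pick-x-CherryIn : ∀ {a b} → a ≢ x → a ≢ y → CherryIn (Ts ∖ D) a b → CherryIn (Ts ∖ (x ∷ D)) a b
    pick-x-CherryIn a≢x a≢y ab rewrite ∖-∷ Ts x D =
      keeps-CherryIn a≢x a≢y (delete-x-forest (Ts ∖ D) paired-after) ab

    pick-x-for-y : Ts ∖ (x ∷ D) ≡ map (rename σ) (Ts ∖ (y ∷ D))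
    pick-x-for-y = begin
      Ts ∖ (x ∷ D)                             ≡⟨ ∖-∷ Ts x D ⟩
      (Ts ∖ D) ∖ [ x ]                         ≡⟨ delete-x≡rename-delete-y-forest (Ts ∖ D) paired-after ⟩
      map (rename σ) ((Ts ∖ D) ∖ [ y ])        ≡⟨ cong (map (rename σ)) (sym (∖-∷ Ts y D)) ⟩
      map (rename σ) (Ts ∖ (y ∷ D))            ∎
      where open ≡-Reasoning

    pick-x-for-y-H : ∀ {z z′} → σ z ≡ z′ → InH (Ts ∖ (y ∷ D)) z →
                     InH (Ts ∖ (x ∷ D)) z′ × (w (Ts ∖ (y ∷ D)) z ≡ w (Ts ∖ (x ∷ D)) z′)
    pick-x-for-y-H {z} refl h rewrite pick-x-for-y =
      rename-InH σ h , sym (transpose-w x≢y (Ts ∖ (y ∷ D)) z)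

  pick-x-first : ∀ P D {Q} → Fresh P → Fresh D → Q ≢ [] → Replaces Ts D (P ++ x ∷ Q) (x ∷ D) (P ++ Q)
  pick-x-first []      D {Q} _ fD Q≢[] c with to (CPSteps-∷ Ts D x Q≢[]) c
  ... | _ , cQ = proj₁ (replaces-↭ Ts Q (++-comm D [ x ]) cQ) , (begin
    weightFrom Ts D (x ∷ Q)                         ≡⟨ weightFrom-∷ Ts D x Q≢[] ⟩
    w (Ts ∖ D) x ℤ.+ weightFrom Ts (D ++ [ x ]) Q   ≡⟨ cong (ℤ._+ weightFrom Ts (D ++ [ x ]) Q) (w-x-after fD) ⟩
    0ℤ ℤ.+ weightFrom Ts (D ++ [ x ]) Q             ≡⟨ +-identityˡ _ ⟩
    weightFrom Ts (D ++ [ x ]) Q                    ≡⟨ proj₂ (replaces-↭ Ts Q (++-comm D [ x ]) cQ) ⟩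
    weightFrom Ts (x ∷ D) Q                         ∎)
    where open ≡-Reasoning
  pick-x-first (p ∷ P) D ((p≢x , p≢y) ∷ fP) fD Q≢[] =
    replaces-∷ Ts (++-≢[] P (λ ())) (++-≢[] P Q≢[]) (pick-x-H fD p≢x p≢y)
      (pick-x-first P (D ++ [ p ]) fP (fresh-snoc fD p≢x p≢y) Q≢[])

  swap-picks : ∀ Q E {R} → Fresh Q → Fresh E → Replaces Ts (y ∷ E) (Q ++ x ∷ R) (x ∷ E) (Q ++ y ∷ R)
  swap-picks []      E {[]}    _ _  _ = tt , refl
  swap-picks []      E {r ∷ R} _ fE   =
    replaces-∷ Ts (λ ()) (λ ()) (pick-x-for-y-H fE (transpose-x x y)) (replaces-↭ Ts (r ∷ R) exchange)
    where
    exchange : (y ∷ E) ++ [ x ] ↭ (x ∷ E) ++ [ y ]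
    exchange = ↭-trans (prep y (++-comm E [ x ])) (↭-trans (swap y x refl) (prep x (++-comm [ y ] E)))
  swap-picks (q ∷ Q) E ((q≢x , q≢y) ∷ fQ) fE =
    replaces-∷ Ts (++-≢[] Q (λ ())) (++-≢[] Q (λ ()))
      (pick-x-for-y-H fE (transpose-other x y q≢x q≢y))
      (swap-picks Q (E ++ [ q ]) fQ (fresh-snoc fE q≢x q≢y))

  realised-front : ∀ P Q {a b} → Fresh P → CPSteps Ts [] (P ++ x ∷ Q) → a ≢ x →
                   Realised Ts (P ++ x ∷ Q) a b → Realised Ts (x ∷ (P ++ Q)) a b
  realised-front P Q {a} {b} fP cp a≢x (pre , post , e , ab , w>0) with split P x Q pre a post e
  ... | before m refl refl =
    x ∷ pre , m ++ Q , cong (x ∷_) (++-assoc pre (a ∷ m) Q) ,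
    pick-x-CherryIn fpre a≢x a≢y ab , subst (_> 0ℤ) (proj₂ (pick-x-H fpre a≢x a≢y h)) w>0
    where
    fpre : Fresh pre
    fpre = AllP.++⁻ˡ pre fP
    a≢y : a ≢ y
    a≢y with AllP.++⁻ʳ pre fP
    ... | (_ , a≢y′) ∷ _ = a≢y′
    h : InH (Ts ∖ pre) a
    h = CPSteps-at Ts [] pre a (++-≢[] m (λ ())) (subst (CPSteps Ts []) (++-assoc pre (a ∷ m) (x ∷ Q)) cp)
  ... | at _ a≡x _ = ⊥-elim (a≢x a≡x)
  ... | after m refl refl =
    x ∷ (P ++ m) , post , cong (x ∷_) (sym (++-assoc P m (a ∷ post))) ,
    subst (λ G → CherryIn G a b) same ab , subst (λ G → w G a > 0ℤ) same w>0
    where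
    same : Ts ∖ (P ++ x ∷ m) ≡ Ts ∖ (x ∷ (P ++ m))
    same = ∖-resp-↭ Ts (shift x P m)

  realised-swap : ∀ P Q R {a b} → Fresh P → Fresh Q → a ≢ x → b ≢ x →
                  Realised Ts (P ++ y ∷ (Q ++ x ∷ R)) a b → Realised Ts (P ++ x ∷ (Q ++ y ∷ R)) a b
  realised-swap P Q R {a} {b} fP fQ a≢x b≢x (pre , post , e , ab , w>0) with split P y (Q ++ x ∷ R) pre a post e
  ... | before m refl refl = pre , m ++ x ∷ (Q ++ y ∷ R) , ++-assoc pre (a ∷ m) _ , ab , w>0
  ... | at refl refl refl = ⊥-elim (0≯0 (subst (_> 0ℤ) (w-y-after fP) w>0))
    where
    0≯0 : ¬ (0ℤ > 0ℤ)
    0≯0 (+<+ ())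
  ... | after m refl e′ with split Q x R m a post e′
  ...   | before k refl refl =
    P ++ x ∷ m , k ++ y ∷ R ,
    trans (cong (λ L → P ++ x ∷ L) (++-assoc m (a ∷ k) (y ∷ R))) (sym (++-assoc P (x ∷ m) (a ∷ (k ++ y ∷ R)))) ,
    subst (λ G → CherryIn G a b) (sym renamed) (subst₂ (CherryIn (map (rename σ) G)) σa σb (rename-CherryIn σ ab)) ,
    subst (λ G → w G a > 0ℤ) (sym renamed)
      (subst (_> 0ℤ) (sym (trans (cong (w (map (rename σ) G)) (sym σa)) (transpose-w x≢y G a))) w>0)
    where
    G : Forest n
    G = Ts ∖ (P ++ y ∷ m)
    fPm : Fresh (P ++ m)
    fPm = AllP.++⁺ fP (AllP.++⁻ˡ m fQ)
    renamed : Ts ∖ (P ++ x ∷ m) ≡ map (rename σ) (Ts ∖ (P ++ y ∷ m))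
    renamed = trans (∖-resp-↭ Ts (shift x P m))
                (trans (pick-x-for-y fPm) (cong (map (rename σ)) (∖-resp-↭ Ts (↭-sym (shift y P m)))))
    σa : σ a ≡ a
    σa with AllP.++⁻ʳ m fQ
    ... | (a≢x′ , a≢y) ∷ _ = transpose-other x y a≢x′ a≢y
    σb : σ b ≡ b
    σb = transpose-other x y b≢x (λ { refl → ∖-partner∉ Ts (P ++ y ∷ m) ab (∈-++⁺ʳ P (here refl)) })
  ...   | at _ a≡x _ = ⊥-elim (a≢x a≡x)
  ...   | after k refl refl =
    P ++ x ∷ (Q ++ y ∷ k) , post ,
    trans (cong (λ L → P ++ x ∷ L) (sym (++-assoc Q (y ∷ k) (a ∷ post)))) (sym (++-assoc P (x ∷ (Q ++ y ∷ k)) (a ∷ post))) ,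
    subst (λ G → CherryIn G a b) same ab , subst (λ G → w G a > 0ℤ) same w>0
    where
    same : Ts ∖ (P ++ y ∷ (Q ++ x ∷ k)) ≡ Ts ∖ (P ++ x ∷ (Q ++ y ∷ k))
    same = ∖-resp-↭ Ts (exchange-↭ P y x Q k)

  Goal : List (Fin n × Fin n) → List (Fin n) → Set
  Goal C s = ∃[ s′ ] ∃[ rest ] (s′ ≡ x ∷ rest) × IsCPS Ts s′ × (weight Ts s′ ≡ weight Ts s) × Satisfies Ts C s′

  module _ (C : List (Fin n × Fin n)) (x∉₁ : x ∉ π₁ C) (x∉₂ : x ∉ π₂ C) where

    -- If y is picked after x, x can be moved to the front.
    move-x-front : ∀ P Q → Fresh P → Q ≢ [] → IsCPS Ts (P ++ x ∷ Q) → Satisfies Ts C (P ++ x ∷ Q) →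
                   Goal C (P ++ x ∷ Q)
    move-x-front P Q fP Q≢[] (perm , cp) sat =
      x ∷ (P ++ Q) , P ++ Q , refl ,
      (↭-trans (↭-sym (shift x P Q)) perm , from (CPSteps-∷ Ts [] x PQ≢[]) (x-in-H-after [] , proj₁ moved)) ,
      (begin
        weightFrom Ts [] (x ∷ (P ++ Q))                 ≡⟨ weightFrom-∷ Ts [] x PQ≢[] ⟩
        w (Ts ∖ []) x ℤ.+ weightFrom Ts [ x ] (P ++ Q)  ≡⟨ cong (ℤ._+ weightFrom Ts [ x ] (P ++ Q)) (w-x-after []) ⟩
        0ℤ ℤ.+ weightFrom Ts [ x ] (P ++ Q)             ≡⟨ +-identityˡ _ ⟩
        weightFrom Ts [ x ] (P ++ Q)                    ≡⟨ sym (proj₂ moved) ⟩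
        weightFrom Ts [] (P ++ x ∷ Q)                   ∎) ,
      satisfies-transfer Ts C (λ a≢x _ → realised-front P Q fP cp a≢x) x∉₁ x∉₂ sat
      where
      open ≡-Reasoning
      PQ≢[] : P ++ Q ≢ []
      PQ≢[] = ++-≢[] P Q≢[]
      moved : CPSteps Ts [ x ] (P ++ Q) × (weightFrom Ts [] (P ++ x ∷ Q) ≡ weightFrom Ts [ x ] (P ++ Q))
      moved = pick-x-first P [] fP [] Q≢[] cp

    swap-x-y : ∀ P Q R → Fresh P → Fresh Q → IsCPS Ts (P ++ y ∷ (Q ++ x ∷ R)) → Satisfies Ts C (P ++ y ∷ (Q ++ x ∷ R)) →
               IsCPS Ts (P ++ x ∷ (Q ++ y ∷ R)) × (weight Ts (P ++ x ∷ (Q ++ y ∷ R)) ≡ weight Ts (P ++ y ∷ (Q ++ x ∷ R)))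
               × Satisfies Ts C (P ++ x ∷ (Q ++ y ∷ R))
    swap-x-y P Q R fP fQ (perm , cp) sat =
      (↭-trans (exchange-↭ P x y Q R) perm , proj₁ swapped) , sym (proj₂ swapped) ,
      satisfies-transfer Ts C (λ a≢x b≢x → realised-swap P Q R fP fQ a≢x b≢x) x∉₁ x∉₂ sat
      where
      swapped : CPSteps Ts [] (P ++ x ∷ (Q ++ y ∷ R)) × (weight Ts (P ++ y ∷ (Q ++ x ∷ R)) ≡ weight Ts (P ++ x ∷ (Q ++ y ∷ R)))
      swapped = replaces-prefix Ts P []
        (replaces-∷ Ts (++-≢[] Q (λ ())) (++-≢[] Q (λ ()))
          (λ _ → x-in-H-after fP , trans (w-y-after fP) (sym (w-x-after fP)))
          (replaces-trans Ts (replaces-↭ Ts (Q ++ x ∷ R) (++-comm P [ y ]))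
            (replaces-trans Ts (swap-picks Q P fQ fP) (replaces-↭ Ts (Q ++ y ∷ R) (++-comm [ x ] P)))))
        cp

    move-x-after-y : ∀ P Q R → Unique (P ++ y ∷ (Q ++ x ∷ R)) → IsCPS Ts (P ++ y ∷ (Q ++ x ∷ R)) →
                     Satisfies Ts C (P ++ y ∷ (Q ++ x ∷ R)) → Goal C (P ++ y ∷ (Q ++ x ∷ R))
    move-x-after-y P Q R unique cps sat with fresh-around P Q R unique
    ... | fP , fQ with swap-x-y P Q R fP fQ cps sat
    ...   | cps′ , swapped , sat′ with move-x-front P (Q ++ y ∷ R) fP (++-≢[] Q (λ ())) cps′ sat′
    ...     | s′ , rest , s′≡ , cps″ , moved , sat″ = s′ , rest , s′≡ , cps″ , trans moved swapped , sat″

    to-front : ∀ s → IsCPS Ts s → Satisfies Ts C s → Goal C s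
    to-front s cps@(perm , _) sat
      with ∈-∃++ (∈-resp-↭ (↭-sym perm) (∈-allFin x)) | ∈-resp-↭ (↭-sym perm) (∈-allFin y)
         | Unique-resp-↭ (setoid (Fin n)) (↭⇒↭ₛ (↭-sym perm)) (allFin⁺ n)
    ... | P , R , refl | y∈s | unique with ∈-++⁻ P y∈s
    ...   | inj₂ (here y≡x)  = ⊥-elim (x≢y (sym y≡x))
    ...   | inj₂ (there y∈R) =
      move-x-front P R (fresh (proj₁ (unique-middle P unique)) (λ y∈P → proj₂ (proj₂ (unique-++ P unique)) y∈P (there y∈R)))
        (∈⇒≢[] y∈R) cps sat
    ...   | inj₁ y∈P with ∈-∃++ y∈P
    ...     | P₁ , Q , refl = subst (Goal C) (sym reassoc)
      (move-x-after-y P₁ Q R (subst Unique reassoc unique) (subst (IsCPS Ts) reassoc cps) (subst (Satisfies Ts C) reassoc sat))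
      where
      reassoc : (P₁ ++ y ∷ Q) ++ x ∷ R ≡ P₁ ++ y ∷ (Q ++ x ∷ R)
      reassoc = ++-assoc P₁ (y ∷ Q) (x ∷ R)

mainTheorem7 : (n : ℕ) (Ts : Forest n) → Ts ≢ [] → All (IsPhyloTree n) Ts
    → (C : List (Fin n × Fin n)) → IsConstraintSet Ts C
    → (s : List (Fin n)) → IsCPS Ts s → Satisfies Ts C s
    → (x : Fin n) → x ∉ π₁ C → x ∉ π₂ C
    → InH Ts x → w Ts x ≡ 0ℤ
    → ∃[ s′ ] ∃[ rest ] (s′ ≡ x ∷ rest) × IsCPS Ts s′ × (weight Ts s′ ≡ weight Ts s) × Satisfies Ts C s′
mainTheorem7 n Ts Ts≢[] phylo C _ s cps sat x x∉π₁ x∉π₂ x∈H w≡0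
  with common-partner Ts≢[] (All.map phylo⇒distinct phylo) x∈H w≡0
... | y , paired = Exchange.to-front Ts Ts≢[] x y paired C x∉π₁ x∉π₂ s cps sat
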